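{- Let $\mathcal N$ be one of the algebras $\langle\mathbb N;\mathrm{Suc}\rangle$, $\langle\mathbb N;+\rangle$, $\langle\mathbb N;+,\times\rangle$. For any $f\colon\mathbb N\to\mathbb N$ the following are equivalent: (i) $f$ is $\mathcal N$-stable-preorder preserving; (ii) $f$ is monotone non-decreasing and $\mathcal N$-congruence preserving; (iii) (a) $y-x$ divides $f(y)-f(x)$ for all $x,y\in\mathbb N$, (b) $f$ is either constant or $f(x)\ge x$ for all $x\in\mathbb N$, and (c) $f$ is monotone non-decreasing.
   Context: A relation on $\mathbb N$ is $\mathcal N$-stable if it is compatible with each operation of $\mathcal N$ (arguments pairwise related imply values related). $\mathcal N$-congruences are stable equivalence relations; $\mathcal N$-stable preorders are stable reflexive transitive relations. $f$ is congruence (resp. stable-preorder) preserving if for every $\mathcal N$-congruence (resp. $\mathcal N$-stable preorder) $\rho$, $x\rho y$ implies $f(x)\rho f(y)$. -}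

module Defs where

open import Data.Nat using (ℕ; suc; _+_; _*_; _≤_)
open import Data.Product using (_×_)
open import Data.Sum using (_⊎_)
open import Data.Integer as ℤ using (+_)
open import Data.Integer.Divisibility as ℤD using ()
open import Relation.Binary.PropositionalEquality using (_≡_)
open import Relation.Binary.Definitions using (Reflexive; Symmetric; Transitive)
open import Level using (0ℓ)
open import Relation.Binary.Core using (Rel)

data Alg : Set where
  SucAlg      : Alg
  PlusAlg     : Alg
  PlusTimesAlg : Alg

Compatible₂ : (ℕ → ℕ → ℕ) → Rel ℕ 0ℓ → Set
Compatible₂ op R = ∀ x y x' y' → R x y → R x' y' → R (op x x') (op y y')

Stable : Alg → Rel ℕ 0ℓ → Set
Stable SucAlg R = ∀ x y → R x y → R (suc x) (suc y)
Stable PlusAlg R = Compatible₂ _+_ R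
Stable PlusTimesAlg R = Compatible₂ _+_ R × Compatible₂ _*_ R

IsCongruence : Alg → Rel ℕ 0ℓ → Set
IsCongruence N R = Reflexive R × Symmetric R × Transitive R × Stable N R

IsStablePreorder : Alg → Rel ℕ 0ℓ → Set
IsStablePreorder N R = Reflexive R × Transitive R × Stable N R

Preserves : (Rel ℕ 0ℓ → Set) → (ℕ → ℕ) → Set₁
Preserves P f = ∀ (R : Rel ℕ 0ℓ) → P R → ∀ x y → R x y → R (f x) (f y)

CongruencePreserving : Alg → (ℕ → ℕ) → Set₁
CongruencePreserving N = Preserves (IsCongruence N)

StablePreorderPreserving : Alg → (ℕ → ℕ) → Set₁
StablePreorderPreserving N = Preserves (IsStablePreorder N)

Monotone : (ℕ → ℕ) → Set
Monotone f = ∀ x y → x ≤ y → f x ≤ f y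

Constant : (ℕ → ℕ) → Set
Constant f = ∀ x y → f x ≡ f y

DiffDivides : (ℕ → ℕ) → Set
DiffDivides f = ∀ x y → (+ y ℤ.- + x) ℤD.∣ (+ f y ℤ.- + f x)

Condition-iii : (ℕ → ℕ) → Set
Condition-iii f = DiffDivides f × (Constant f ⊎ (∀ x → x ≤ f x)) × Monotone f

-- (i) ⇒ (ii): _≤_ is a stable preorder and every congruence is one.
-- (ii) ⇒ (iii): divisibility comes from the congruence "y − x divides the
-- difference".  If f x < x for some x, the congruence identifying all numbers
-- ≥ x makes f constant on [x, ∞); divisibility by arbitrarily large distances
-- then makes f constant everywhere.  So f is constant or inflationary.
-- (iii) ⇒ (i): every stable preorder R is compatible with suc, so R a b with
-- a ≤ b gives R c (c + (b − a)) for all c ≥ a; starting at c = f a ≥ a and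
-- chaining q such steps reaches f b = f a + q (b − a).
module Submission where

open import Defs
open import Data.Nat using (ℕ; zero; suc; _+_; _*_; _∸_; _≤_; _<_; ∣_-_∣; s≤s; s≤s⁻¹; _≤?_)
open import Data.Nat.Properties
open import Data.Nat.Divisibility using (_∣_; divides-refl; >⇒∤)
open import Data.Integer as ℤ using (ℤ; +_; _⊖_)
import Data.Integer.Properties as ℤ
import Data.Integer.Divisibility.Signed as ℤ∣
open import Data.Integer.Tactic.RingSolver using (solve-∀)
open import Data.Product using (_×_; _,_)
open import Data.Sum using (_⊎_; inj₁; inj₂)
open import Function using (_∘_; flip)
open import Function.Bundles using (_⇔_; mk⇔)
open import Level using (0ℓ)
open import Relation.Binary.Core using (Rel)
open import Relation.Binary.Definitions using (Reflexive; Symmetric; Transitive)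
open import Relation.Binary.PropositionalEquality
open import Relation.Nullary using (yes; no; contradiction)

private
  variable
    R : Rel ℕ 0ℓ
    f : ℕ → ℕ

+-compatible⇒suc-stable : Reflexive R → Compatible₂ _+_ R → Stable SucAlg R
+-compatible⇒suc-stable R-refl +-compat x y = +-compat 1 1 x y R-refl

+-*-compatible⇒stable : ∀ N → Reflexive R → Compatible₂ _+_ R → Compatible₂ _*_ R → Stable N R
+-*-compatible⇒stable SucAlg       R-refl +-compat _        = +-compatible⇒suc-stable R-refl +-compat
+-*-compatible⇒stable PlusAlg      _      +-compat _        = +-compat
+-*-compatible⇒stable PlusTimesAlg R-refl +-compat *-compat = +-compat , *-compat

stable⇒suc-stable : ∀ N → Reflexive R → Stable N R → Stable SucAlg R
stable⇒suc-stable SucAlg       _      suc-compat     = suc-compat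
stable⇒suc-stable PlusAlg      R-refl +-compat       = +-compatible⇒suc-stable R-refl +-compat
stable⇒suc-stable PlusTimesAlg R-refl (+-compat , _) = +-compatible⇒suc-stable R-refl +-compat

isCongruence : ∀ N → Reflexive R → Symmetric R → Transitive R →
               Compatible₂ _+_ R → Compatible₂ _*_ R → IsCongruence N R
isCongruence N R-refl R-sym R-trans +-compat *-compat =
  R-refl , R-sym , R-trans , +-*-compatible⇒stable N R-refl +-compat *-compat

≤-isStablePreorder : ∀ N → IsStablePreorder N _≤_
≤-isStablePreorder N = ≤-refl , ≤-trans ,
  +-*-compatible⇒stable N ≤-refl (λ _ _ _ _ → +-mono-≤) (λ _ _ _ _ → *-mono-≤)

Modulo : ℤ → Rel ℕ 0ℓ
Modulo m a b = m ℤ∣.∣ (+ b ℤ.- + a)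

module _ (m : ℤ) where

  modulo-refl : Reflexive (Modulo m)
  modulo-refl {a} = ℤ∣.divides (+ 0) (trans (ℤ.+-inverseʳ (+ a)) (sym (ℤ.*-zeroˡ m)))

  modulo-sym : Symmetric (Modulo m)
  modulo-sym {a} {b} m∣b-a = subst (m ℤ∣.∣_) (negate (+ a) (+ b)) (ℤ∣.∣m⇒∣-m m∣b-a)
    where
    negate : ∀ i j → ℤ.- (j ℤ.- i) ≡ i ℤ.- j
    negate = solve-∀

  modulo-trans : Transitive (Modulo m)
  modulo-trans {a} {b} {c} m∣b-a m∣c-b =
    subst (m ℤ∣.∣_) (telescope (+ a) (+ b) (+ c)) (ℤ∣.∣m∣n⇒∣m+n m∣b-a m∣c-b)
    where
    telescope : ∀ i j k → (j ℤ.- i) ℤ.+ (k ℤ.- j) ≡ k ℤ.- i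
    telescope = solve-∀

  modulo-+-compatible : Compatible₂ _+_ (Modulo m)
  modulo-+-compatible x y x′ y′ m∣y-x m∣y′-x′ =
    subst (m ℤ∣.∣_) difference (ℤ∣.∣m∣n⇒∣m+n m∣y-x m∣y′-x′)
    where
    sum-of-differences : ∀ i j i′ j′ → (j ℤ.- i) ℤ.+ (j′ ℤ.- i′) ≡ (j ℤ.+ j′) ℤ.- (i ℤ.+ i′)
    sum-of-differences = solve-∀
    difference : (+ y ℤ.- + x) ℤ.+ (+ y′ ℤ.- + x′) ≡ + (y + y′) ℤ.- + (x + x′)
    difference = trans (sum-of-differences (+ x) (+ y) (+ x′) (+ y′))
                       (sym (cong₂ ℤ._-_ (ℤ.pos-+ y y′) (ℤ.pos-+ x x′)))

  modulo-*-compatible : Compatible₂ _*_ (Modulo m)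
  modulo-*-compatible x y x′ y′ m∣y-x m∣y′-x′ =
    subst (m ℤ∣.∣_) difference
      (ℤ∣.∣m∣n⇒∣m+n (ℤ∣.∣n⇒∣m*n (+ y) m∣y′-x′) (ℤ∣.∣m⇒∣m*n (+ x′) m∣y-x))
    where
    product-difference : ∀ i j i′ j′ → j ℤ.* (j′ ℤ.- i′) ℤ.+ (j ℤ.- i) ℤ.* i′ ≡ (j ℤ.* j′) ℤ.- (i ℤ.* i′)
    product-difference = solve-∀
    difference : + y ℤ.* (+ y′ ℤ.- + x′) ℤ.+ (+ y ℤ.- + x) ℤ.* + x′ ≡ + (y * y′) ℤ.- + (x * x′)
    difference = trans (product-difference (+ x) (+ y) (+ x′) (+ y′))
                       (sym (cong₂ ℤ._-_ (ℤ.pos-* y y′) (ℤ.pos-* x x′)))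

  modulo-isCongruence : ∀ N → IsCongruence N (Modulo m)
  modulo-isCongruence N = isCongruence N (λ {a} → modulo-refl {a}) (λ {a b} → modulo-sym {a} {b})
    (λ {a b c} → modulo-trans {a} {b} {c}) modulo-+-compatible modulo-*-compatible

EqualOrBothAbove : ℕ → Rel ℕ 0ℓ
EqualOrBothAbove t a b = a ≡ b ⊎ (t < a × t < b)

module _ (t : ℕ) where

  equalOrBothAbove-sym : Symmetric (EqualOrBothAbove t)
  equalOrBothAbove-sym (inj₁ a≡b)         = inj₁ (sym a≡b)
  equalOrBothAbove-sym (inj₂ (t<a , t<b)) = inj₂ (t<b , t<a)

  equalOrBothAbove-trans : Transitive (EqualOrBothAbove t)
  equalOrBothAbove-trans (inj₁ refl)      r                = r
  equalOrBothAbove-trans (inj₂ t<a,b)     (inj₁ refl)      = inj₂ t<a,b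
  equalOrBothAbove-trans (inj₂ (t<a , _)) (inj₂ (_ , t<c)) = inj₂ (t<a , t<c)

  equalOrBothAbove-+-compatible : Compatible₂ _+_ (EqualOrBothAbove t)
  equalOrBothAbove-+-compatible x y x′ y′ (inj₁ refl) (inj₁ refl) = inj₁ refl
  equalOrBothAbove-+-compatible x y x′ y′ (inj₂ (t<x , t<y)) _ =
    inj₂ (≤-trans t<x (m≤m+n x x′) , ≤-trans t<y (m≤m+n y y′))
  equalOrBothAbove-+-compatible x y x′ y′ (inj₁ refl) (inj₂ (t<x′ , t<y′)) =
    inj₂ (≤-trans t<x′ (m≤n+m x′ x) , ≤-trans t<y′ (m≤n+m y′ x))

  equalOrBothAbove-*-compatible : Compatible₂ _*_ (EqualOrBothAbove t)
  equalOrBothAbove-*-compatible x y x′ y′ (inj₁ refl) (inj₁ refl) = inj₁ refl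
  equalOrBothAbove-*-compatible x y zero .zero (inj₂ _) (inj₁ refl) =
    inj₁ (trans (*-zeroʳ x) (sym (*-zeroʳ y)))
  equalOrBothAbove-*-compatible x y x′@(suc _) .x′ (inj₂ (t<x , t<y)) (inj₁ refl) =
    inj₂ (≤-trans t<x (m≤m*n x x′) , ≤-trans t<y (m≤m*n y x′))
  equalOrBothAbove-*-compatible x y x′@(suc _) y′@(suc _) (inj₂ (t<x , t<y)) (inj₂ _) =
    inj₂ (≤-trans t<x (m≤m*n x x′) , ≤-trans t<y (m≤m*n y y′))
  equalOrBothAbove-*-compatible zero .zero x′ y′ (inj₁ refl) (inj₂ _) = inj₁ refl
  equalOrBothAbove-*-compatible x@(suc _) .x x′ y′ (inj₁ refl) (inj₂ (t<x′ , t<y′)) =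
    inj₂ (≤-trans t<x′ (m≤n*m x′ x) , ≤-trans t<y′ (m≤n*m y′ x))

  equalOrBothAbove-isCongruence : ∀ N → IsCongruence N (EqualOrBothAbove t)
  equalOrBothAbove-isCongruence N = isCongruence N (inj₁ refl) equalOrBothAbove-sym
    equalOrBothAbove-trans equalOrBothAbove-+-compatible equalOrBothAbove-*-compatible

∣[+m]-[+n]∣≡∣m-n∣ : ∀ m n → ℤ.∣ + m ℤ.- + n ∣ ≡ ∣ m - n ∣
∣[+m]-[+n]∣≡∣m-n∣ m n with ≤-total m n
... | inj₁ m≤n = begin
  ℤ.∣ + m ℤ.- + n ∣ ≡⟨ cong ℤ.∣_∣ (ℤ.[+m]-[+n]≡m⊖n m n) ⟩
  ℤ.∣ m ⊖ n ∣       ≡⟨ ℤ.∣⊖∣-≤ m≤n ⟩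
  n ∸ m             ≡⟨ m≤n⇒∣m-n∣≡n∸m m≤n ⟨
  ∣ m - n ∣         ∎
  where open ≡-Reasoning
... | inj₂ n≤m = begin
  ℤ.∣ + m ℤ.- + n ∣ ≡⟨ cong ℤ.∣_∣ (ℤ.[+m]-[+n]≡m⊖n m n) ⟩
  ℤ.∣ m ⊖ n ∣       ≡⟨ ℤ.∣m⊖n∣≡∣n⊖m∣ m n ⟩
  ℤ.∣ n ⊖ m ∣       ≡⟨ ℤ.∣⊖∣-≤ n≤m ⟩
  m ∸ n             ≡⟨ m≤n⇒∣n-m∣≡n∸m n≤m ⟨
  ∣ m - n ∣         ∎
  where open ≡-Reasoning

DistanceDivides : (ℕ → ℕ) → Set
DistanceDivides f = ∀ x y → ∣ x - y ∣ ∣ ∣ f x - f y ∣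

diffDivides⇒distanceDivides : DiffDivides f → DistanceDivides f
diffDivides⇒distanceDivides {f} divides x y =
  subst₂ _∣_ (∣[+m]-[+n]∣≡∣m-n∣ x y) (∣[+m]-[+n]∣≡∣m-n∣ (f x) (f y)) (divides y x)

module SucStablePreorder (R-refl : Reflexive R) (R-trans : Transitive R) (R-suc : Stable SucAlg R) where

  +-compatibleˡ : ∀ k {a b} → R a b → R (k + a) (k + b)
  +-compatibleˡ zero    r = r
  +-compatibleˡ (suc k) r = R-suc _ _ (+-compatibleˡ k r)

  stride-from : ∀ {a c d} → a ≤ c → R a (a + d) → R c (c + d)
  stride-from {a} {c} {d} a≤c r = subst₂ R (m∸n+n≡m a≤c) shifted (+-compatibleˡ (c ∸ a) r)
    where
    shifted : (c ∸ a) + (a + d) ≡ c + d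
    shifted = trans (sym (+-assoc (c ∸ a) a d)) (cong (_+ d) (m∸n+n≡m a≤c))

  stride-* : ∀ q {a c d} → a ≤ c → R a (a + d) → R c (c + q * d)
  stride-* zero    {c = c}         a≤c r = subst (R c) (sym (+-identityʳ c)) R-refl
  stride-* (suc q) {c = c} {d = d} a≤c r =
    R-trans (stride-from a≤c r)
            (subst (R (c + d)) (+-assoc c d (q * d)) (stride-* q (≤-trans a≤c (m≤m+n c d)) r))

  stride-∣ : ∀ {a c d e} → a ≤ c → d ∣ e → R a (a + d) → R c (c + e)
  stride-∣ a≤c (divides-refl q) = stride-* q a≤c

  preserves-≤ : Monotone f → (∀ x → x ≤ f x) → DistanceDivides f →
                ∀ {a b} → a ≤ b → R a b → R (f a) (f b)
  preserves-≤ {f} monotone inflationary divides {a} {b} a≤b r =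
    subst (R (f a)) (m+[n∸m]≡n fa≤fb)
      (stride-∣ (inflationary a) step∣image-step (subst (R a) (sym (m+[n∸m]≡n a≤b)) r))
    where
    fa≤fb : f a ≤ f b
    fa≤fb = monotone a b a≤b
    step∣image-step : (b ∸ a) ∣ (f b ∸ f a)
    step∣image-step = subst₂ _∣_ (m≤n⇒∣m-n∣≡n∸m a≤b) (m≤n⇒∣m-n∣≡n∸m fa≤fb) (divides a b)

preservesSucStablePreorders : Monotone f → (∀ x → x ≤ f x) → DistanceDivides f →
  Reflexive R → Transitive R → Stable SucAlg R → ∀ x y → R x y → R (f x) (f y)
preservesSucStablePreorders monotone inflationary divides R-refl R-trans R-suc x y r
  with ≤-total x y
... | inj₁ x≤y = SucStablePreorder.preserves-≤ R-refl R-trans R-suc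
                   monotone inflationary divides x≤y r
... | inj₂ y≤x = SucStablePreorder.preserves-≤ R-refl (flip R-trans) (flip R-suc)
                   monotone inflationary divides y≤x r

module _ {N : Alg} {f : ℕ → ℕ} (preserving : CongruencePreserving N f) where

  congruencePreserving⇒diffDivides : DiffDivides f
  congruencePreserving⇒diffDivides x y =
    ℤ∣.∣⇒∣ᵤ (preserving (Modulo m) (modulo-isCongruence m N) x y ℤ∣.∣-refl)
    where m = + y ℤ.- + x

  -- f identifies the class [x, ∞) of EqualOrBothAbove (x − 1) with the class of f x,
  -- which is a singleton because f x < x.
  below-diagonal⇒eventually-constant : ∀ {x} → f x < x → ∀ y → x ≤ y → f y ≡ f x
  below-diagonal⇒eventually-constant {suc t} fx<x y x≤y
    with preserving (EqualOrBothAbove t) (equalOrBothAbove-isCongruence t N)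
                    (suc t) y (inj₂ (≤-refl , x≤y))
  ... | inj₁ fx≡fy      = sym fx≡fy
  ... | inj₂ (t<fx , _) = contradiction (s≤s⁻¹ fx<x) (<⇒≱ t<fx)

∣∧<⇒≡0 : ∀ {m n} → m ∣ n → n < m → n ≡ 0
∣∧<⇒≡0 {n = zero}  _   _   = refl
∣∧<⇒≡0 {n = suc _} m∣n n<m = contradiction m∣n (>⇒∤ n<m)

eventually-constant⇒constant : DistanceDivides f → ∀ {x} → (∀ y → x ≤ y → f y ≡ f x) → Constant f
eventually-constant⇒constant {f} divides {x} eventually a b = trans (≡fx a) (sym (≡fx b))
  where
  -- z and a point y far above max(z, x) have distance exceeding ∣ f z - f y ∣ = ∣ f z - f x ∣.
  ≡fx : ∀ z → f z ≡ f x
  ≡fx z = ∣m-n∣≡0⇒m≡n (∣∧<⇒≡0 far∣D (s≤s (m≤m+n D x)))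
    where
    D = ∣ f z - f x ∣
    y = z + (suc D + x)
    far∣D : suc D + x ∣ D
    far∣D = subst₂ _∣_ (∣m-m+n∣≡n z (suc D + x))
                       (cong (λ w → ∣ f z - w ∣) (eventually y (≤-trans (m≤n+m x (suc D)) (m≤n+m _ z))))
                       (divides z y)

constant-or-inflationary : (∀ x → f x < x → Constant f) → Constant f ⊎ (∀ x → x ≤ f x)
constant-or-inflationary {f} below⇒constant with suc (f 0) ≤? f (suc (f 0))
... | no  fx₀≱x₀ = inj₁ (below⇒constant _ (≰⇒> fx₀≱x₀))
... | yes fx₀≥x₀ = inj₂ inflationary
  where
  -- For x₀ = suc (f 0), x₀ ≤ f x₀ rules out constancy, hence any point below the diagonal.
  inflationary : ∀ x → x ≤ f x
  inflationary x with x ≤? f x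
  ... | yes x≤fx = x≤fx
  ... | no  x≰fx = contradiction (below⇒constant x (≰⇒> x≰fx) (suc (f 0)) 0) (>⇒≢ fx₀≥x₀)

i⇒ii : ∀ N f → StablePreorderPreserving N f → Monotone f × CongruencePreserving N f
i⇒ii N f preserving =
  preserving _≤_ (≤-isStablePreorder N) ,
  λ R (R-refl , _ , R-trans , R-stable) → preserving R (R-refl , R-trans , R-stable)

ii⇒iii : ∀ N f → Monotone f × CongruencePreserving N f → Condition-iii f
ii⇒iii N f (monotone , preserving) =
  divides ,
  constant-or-inflationary (λ _ fx<x → eventually-constant⇒constant
    (diffDivides⇒distanceDivides {f} divides) (below-diagonal⇒eventually-constant preserving fx<x)) ,
  monotone
  where divides = congruencePreserving⇒diffDivides preserving

iii⇒i : ∀ N f → Condition-iii f → StablePreorderPreserving N f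
iii⇒i N f (_ , inj₁ constant , _) R (R-refl , _) x y _ = subst (R (f x)) (constant x y) R-refl
iii⇒i N f (divides , inj₂ inflationary , monotone) R (R-refl , R-trans , R-stable) =
  preservesSucStablePreorders monotone inflationary (diffDivides⇒distanceDivides {f} divides)
    R-refl R-trans (stable⇒suc-stable N R-refl R-stable)

theorem3p10 : (N : Alg) (f : ℕ → ℕ) →
    (StablePreorderPreserving N f ⇔ (Monotone f × CongruencePreserving N f))
      × ((Monotone f × CongruencePreserving N f) ⇔ Condition-iii f)
theorem3p10 N f =
  mk⇔ (i⇒ii N f) (iii⇒i N f ∘ ii⇒iii N f) ,
  mk⇔ (ii⇒iii N f) (i⇒ii N f ∘ iii⇒i N f)
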